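{- For each odd integer $t \ge 3$ and each prime $p \ge 5$, the set $L_t = \{0, t-2, t-1, t, t+1, 2t-1\}$ contains an element whose remainder modulo $p$ differs from the remainders modulo $p$ of all other elements of $L_t$. -}

module Defs where

open import Data.Nat using (ℕ; _+_; _*_; _∸_)
open import Data.List using (List; _∷_; [])

-- L_t = {0, t-2, t-1, t, t+1, 2t-1}  (as a list; for t ≥ 3 all entries are distinct naturals)
L : ℕ → List ℕ
L t = 0 ∷ (t ∸ 2) ∷ (t ∸ 1) ∷ t ∷ (t + 1) ∷ (2 * t ∸ 1) ∷ []

{-# OPTIONS --safe #-}
module Submission where

open import Defs
open import Data.Nat using (ℕ; suc; _+_; _*_; _∸_; _%_; _/_; _≤_; _<_; s≤s; NonZero)
open import Data.Nat.Properties using (+-comm; +-assoc; <-trans; <⇒≤; n<1+n; +-cancelˡ-≡; +-identityʳ)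
open import Data.Nat.DivMod using (m≡m%n+[m/n]*n)
open import Data.Nat.Divisibility using (_∣_; _∤_; _∣?_; divides; ∣m+n∣m⇒∣n; n∣m*n; >⇒∤)
open import Data.Nat.Primality using (Prime)
open import Data.Nat.Tactic.RingSolver using (solve-∀)
open import Data.List.Membership.Propositional using (_∈_)
open import Data.List.Relation.Unary.All as All using (All; []; _∷_)
open import Data.List.Relation.Unary.Any using (here; there)
open import Data.Product using (∃-syntax; _×_; _,_)
open import Function using (const)
open import Relation.Binary.PropositionalEquality
  using (_≡_; _≢_; refl; sym; trans; cong; subst; module ≡-Reasoning)
open import Relation.Nullary using (¬_; yes; no; contradiction)

-- Write t = 2 + u, so L t = {0, u, u+1, u+2, u+3, 2u+3}. Two residues are distinct as
-- soon as the difference of the numbers is not divisible by p, and the differences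
-- 1, 2, 3 never are once p > 3. Hence u+3 is isolated if p ∣ u+2, u is isolated if
-- p ∣ u+1, and u+1 is isolated otherwise.

module _ {p : ℕ} where

  ∣n∧∤m⇒∤m+n : ∀ {m n} → p ∣ n → p ∤ m → p ∤ m + n
  ∣n∧∤m⇒∤m+n {m} {n} p∣n p∤m p∣m+n =
    p∤m (∣m+n∣m⇒∣n (subst (p ∣_) (+-comm m n) p∣m+n) p∣n)

  ∣m+n∧∤m⇒∤n : ∀ {m n} → p ∣ m + n → p ∤ m → p ∤ n
  ∣m+n∧∤m⇒∤n p∣m+n p∤m p∣n = ∣n∧∤m⇒∤m+n p∣n p∤m p∣m+n

  data Apart (x y : ℕ) : Set where
    above : ∀ {d} → p ∤ d → y ≡ d + x → Apart x y
    below : ∀ {d} → p ∤ d → x ≡ d + y → Apart x y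

  self-apart : ∀ {x} → x ≢ x → Apart x x
  self-apart x≢x = contradiction refl x≢x

module _ {p : ℕ} .{{_ : NonZero p}} where

  [m+n]%p≡n%p⇒p∣m : ∀ m n → (m + n) % p ≡ n % p → p ∣ m
  [m+n]%p≡n%p⇒p∣m m n eq = ∣m+n∣m⇒∣n p∣n/p*p+m (n∣m*n (n / p))
    where
    open ≡-Reasoning
    n%p+[n/p*p+m]≡n%p+[m+n]/p*p : n % p + (n / p * p + m) ≡ n % p + (m + n) / p * p
    n%p+[n/p*p+m]≡n%p+[m+n]/p*p = begin
      n % p + (n / p * p + m)       ≡⟨ +-assoc (n % p) _ m ⟨
      n % p + n / p * p + m         ≡⟨ +-comm _ m ⟩
      m + (n % p + n / p * p)       ≡⟨ cong (m +_) (m≡m%n+[m/n]*n n p) ⟨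
      m + n                         ≡⟨ m≡m%n+[m/n]*n (m + n) p ⟩
      (m + n) % p + (m + n) / p * p ≡⟨ cong (_+ (m + n) / p * p) eq ⟩
      n % p + (m + n) / p * p       ∎
    p∣n/p*p+m : p ∣ n / p * p + m
    p∣n/p*p+m = divides ((m + n) / p) (+-cancelˡ-≡ (n % p) _ _ n%p+[n/p*p+m]≡n%p+[m+n]/p*p)

  apart⇒%≢ : ∀ {x y} → Apart {p} x y → y % p ≢ x % p
  apart⇒%≢ {x} (above p∤d refl) eq = p∤d ([m+n]%p≡n%p⇒p∣m _ x eq)
  apart⇒%≢ {y = y} (below p∤d refl) eq = p∤d ([m+n]%p≡n%p⇒p∣m _ y (sym eq))

2*[2+u]∸1≡[1+u]+[2+u] : ∀ u → 2 * (2 + u) ∸ 1 ≡ (1 + u) + (2 + u)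
2*[2+u]∸1≡[1+u]+[2+u] u = cong ((1 + u) +_) (+-identityʳ (2 + u))

module _ {p : ℕ} (3<p : 3 < p) where

  private
    p∤3 : p ∤ 3
    p∤3 = >⇒∤ 3<p

    p∤2 : p ∤ 2
    p∤2 = >⇒∤ (<-trans (n<1+n 2) 3<p)

    p∤1 : p ∤ 1
    p∤1 = >⇒∤ (<-trans (n<1+n 1) (<-trans (n<1+n 2) 3<p))

  L-has-apart-element : ∀ u → ∃[ x ] (x ∈ L (2 + u) × All (λ y → y ≢ x → Apart {p} x y) (L (2 + u)))
  L-has-apart-element u with p ∣? 2 + u | p ∣? 1 + u
  ... | yes p∣2+u | _ =
    2 + u + 1 , there (there (there (there (here refl)))) ,
    const (below (∣n∧∤m⇒∤m+n p∣2+u p∤1) (trans 2+u+1≡3+u (sym (+-identityʳ (3 + u))))) ∷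
    const (below p∤3 2+u+1≡3+u) ∷
    const (below p∤2 2+u+1≡3+u) ∷
    const (below p∤1 2+u+1≡3+u) ∷
    self-apart ∷
    const (above (∣m+n∧∤m⇒∤n p∣2+u p∤2) (trans (2*[2+u]∸1≡[1+u]+[2+u] u) ([1+u]+[2+u]≡u+[2+u+1] u))) ∷ []
    where
    2+u+1≡3+u : 2 + u + 1 ≡ 3 + u
    2+u+1≡3+u = +-comm (2 + u) 1
    [1+u]+[2+u]≡u+[2+u+1] : ∀ u → (1 + u) + (2 + u) ≡ u + (2 + u + 1)
    [1+u]+[2+u]≡u+[2+u+1] = solve-∀
  ... | no _ | yes p∣1+u =
    u , there (here refl) ,
    const (below (∣m+n∧∤m⇒∤n p∣1+u p∤1) (sym (+-identityʳ u))) ∷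
    self-apart ∷
    const (above p∤1 refl) ∷
    const (above p∤2 refl) ∷
    const (above p∤3 (+-comm (2 + u) 1)) ∷
    const (above (∣n∧∤m⇒∤m+n p∣1+u p∤2) (trans (2*[2+u]∸1≡[1+u]+[2+u] u) ([1+u]+[2+u]≡[3+u]+u u))) ∷ []
    where
    [1+u]+[2+u]≡[3+u]+u : ∀ u → (1 + u) + (2 + u) ≡ (3 + u) + u
    [1+u]+[2+u]≡[3+u]+u = solve-∀
  ... | no p∤2+u | no p∤1+u =
    1 + u , there (there (here refl)) ,
    const (below p∤1+u (sym (+-identityʳ (1 + u)))) ∷
    const (below p∤1 refl) ∷
    self-apart ∷
    const (above p∤1 refl) ∷
    const (above p∤2 (+-comm (2 + u) 1)) ∷
    const (above p∤2+u (trans (2*[2+u]∸1≡[1+u]+[2+u] u) (+-comm (1 + u) (2 + u)))) ∷ []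

lemma7 : ∀ (t p : ℕ) → 3 ≤ t → ¬ (∃[ k ] (t ≡ 2 * k)) → Prime p → 5 ≤ p → .{{_ : NonZero p}} →
           ∃[ x ] ((x ∈ L t) × (∀ y → y ∈ L t → y ≢ x → y % p ≢ x % p))
lemma7 (suc (suc u)) p (s≤s (s≤s _)) _ _ 5≤p
  with x , x∈L , apart ← L-has-apart-element (<⇒≤ 5≤p) u =
  x , x∈L , λ y y∈L y≢x → apart⇒%≢ (All.lookup apart y∈L y≢x)
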